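{- $T_2(5)=9$; that is, every triangle-free graph on $9$ vertices contains a $2$-sparse set of $5$ vertices, and there is a triangle-free graph on $8$ vertices containing no $2$-sparse set of $5$ vertices.
   Context: All graphs are finite and simple. A set $S$ of vertices of a graph $G$ is $k$-sparse if the induced subgraph $G[S]$ has maximum degree at most $k$. For integers $k\ge0$ and $j\ge1$, $T_k(j)$ denotes the minimum $n$ such that every triangle-free graph on $n$ vertices contains a $k$-sparse set of $j$ vertices. -}

module Defs where

open import Data.Nat using (ℕ; _≤_; _<_)
open import Data.Bool using (Bool; true; false)
open import Data.Fin using (Fin)
open import Data.Fin.Subset using (Subset; _∈_; _∩_; ∣_∣)
open import Data.Vec using (tabulate)
open import Data.Product using (Σ; _×_)
open import Data.Empty using (⊥)
open import Relation.Nullary using (¬_)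
open import Relation.Binary.PropositionalEquality using (_≡_)

record Graph (n : ℕ) : Set where
  field
    adj    : Fin n → Fin n → Bool
    sym    : ∀ u v → adj u v ≡ adj v u
    irrefl : ∀ v → adj v v ≡ false
open Graph public

-- No three pairwise adjacent vertices (distinctness is automatic by irreflexivity).
TriangleFree : ∀ {n} → Graph n → Set
TriangleFree G = ∀ u v w → adj G u v ≡ true → adj G v w ≡ true → adj G u w ≡ true → ⊥

nbhd : ∀ {n} → Graph n → Fin n → Subset n
nbhd G v = tabulate (adj G v)

Sparse : ∀ {n} → ℕ → Graph n → Subset n → Set
Sparse k G S = ∀ v → v ∈ S → ∣ S ∩ nbhd G v ∣ ≤ k

HasSparseSet : ∀ {n} → ℕ → ℕ → Graph n → Set
HasSparseSet k j G = Σ (Subset _) λ S → (∣ S ∣ ≡ j) × Sparse k G S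

Good : ℕ → ℕ → ℕ → Set
Good k j n = (G : Graph n) → TriangleFree G → HasSparseSet k j G

T≡ : ℕ → ℕ → ℕ → Set
T≡ k j n = Good k j n × (∀ m → m < n → ¬ Good k j m)

-- Lower bound: for m ≤ 8 the first m vertices of K₄,₄ form a triangle-free
-- graph with no 2-sparse 5-set.  A 5-set meets the sides in a and b vertices
-- with a + b = 5 and a, b ≤ 4, and a vertex on one side is adjacent to all
-- chosen vertices of the other, so some vertex has degree at least 3.
--
-- Upper bound: a search tree over the graphs on 9 vertices that decides the
-- 36 vertex pairs one at a time.  A branch is closed as soon as the decided
-- pairs exhibit a triangle, or a 5-set in which every vertex has at most 2
-- neighbours even when the undecided pairs are counted as edges; either
-- witness survives in every completion of the branch, and evaluation
-- confirms that every branch closes.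
module Submission where

open import Defs
open import Data.Bool using (Bool; true; false; T; _∧_; _∨_; _xor_)
open import Data.Bool.Properties using (T-∧; T-∨; T-≡; xor-same; xor-comm)
  renaming (_≟_ to _≟ᵇ_)
open import Data.Empty using (⊥-elim)
open import Data.Fin using (Fin; toℕ; fromℕ<)
  renaming (_<_ to _<ᶠ_)
open import Data.Fin.Properties using (_≟_; _<?_; <-cmp; all?; toℕ-fromℕ<)
open import Data.Fin.Subset using (Subset; _∈_; _⊆_; _∩_; ∣_∣; ⁅_⁆; ⋃)
open import Data.Fin.Subset.Properties using (_∈?_; anySubset?; p⊆q⇒∣p∣≤∣q∣; x∈p∩q⁺; x∈p∩q⁻)
open import Data.List using (List; []; _∷_; _++_; _∷ʳ_; [_]; map; filter; allFin; cartesianProduct)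
open import Data.List.Properties using (∷ʳ-++)
open import Data.List.Relation.Unary.Any using (any?; satisfied)
open import Data.Maybe using (Maybe; just; nothing; fromMaybe)
import Data.Maybe as Maybe
import Data.Maybe.Properties as Maybe
open import Data.Nat using (ℕ; zero; suc; _+_; _∸_; _≤_; _<_; _<ᵇ_)
import Data.Nat.Properties as ℕ
open import Data.Product using (_×_; _,_; ∃; proj₁; proj₂; uncurry)
import Data.Product.Properties as Product
open import Data.Sum using (inj₁; inj₂)
open import Data.Vec using (tabulate)
open import Data.Vec.Properties using (lookup∘tabulate; tabulate-cong; []=⇒lookup; lookup⇒[]=)
open import Function using (_∘_; Equivalence)
open import Relation.Binary using (tri<; tri≈; tri>)
open import Relation.Binary.PropositionalEquality as ≡ using (_≡_; refl; trans; cong; subst)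
open import Relation.Nullary using (Dec; isYes; ¬_; ¬?)
open import Relation.Nullary.Decidable using (_×-dec_; _→-dec_; toWitness)

open Equivalence using (to; from)

combinations : {A : Set} → ℕ → List A → List (List A)
combinations zero    xs       = [ [] ]
combinations (suc k) []       = []
combinations (suc k) (x ∷ xs) = map (x ∷_) (combinations k xs) ++ combinations (suc k) xs

_!?_ : {A : Set} → List A → ℕ → Maybe A
[]       !? i     = nothing
(x ∷ xs) !? zero  = just x
(x ∷ xs) !? suc i = xs !? i

!?-++ : {A : Set} (xs ys : List A) (i : ℕ) {x : A} → xs !? i ≡ just x → (xs ++ ys) !? i ≡ just x
!?-++ (x ∷ xs) ys zero    eq = eq
!?-++ (x ∷ xs) ys (suc i) eq = !?-++ xs ys i eq

!?-map : {A B : Set} (f : A → B) (xs : List A) (i : ℕ) → map f xs !? i ≡ Maybe.map f (xs !? i)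
!?-map f []       i       = refl
!?-map f (x ∷ xs) zero    = refl
!?-map f (x ∷ xs) (suc i) = !?-map f xs i

∈-tabulate⁺ : ∀ {n} {f : Fin n → Bool} {i} → f i ≡ true → i ∈ tabulate f
∈-tabulate⁺ {f = f} {i} fi = lookup⇒[]= i _ (trans (lookup∘tabulate f i) fi)

∈-tabulate⁻ : ∀ {n} {f : Fin n → Bool} {i} → i ∈ tabulate f → f i ≡ true
∈-tabulate⁻ {f = f} {i} i∈ = trans (≡.sym (lookup∘tabulate f i)) ([]=⇒lookup i∈)

∩-tabulate-⊆ : ∀ {n} (S : Subset n) {f g : Fin n → Bool} →
               (∀ i → f i ≡ true → g i ≡ true) → S ∩ tabulate f ⊆ S ∩ tabulate g
∩-tabulate-⊆ S {f} f⇒g {i} i∈ = x∈p∩q⁺ (i∈S , ∈-tabulate⁺ (f⇒g i (∈-tabulate⁻ i∈f)))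
  where
  i∈S = proj₁ (x∈p∩q⁻ S (tabulate f) i∈)
  i∈f = proj₂ (x∈p∩q⁻ S (tabulate f) i∈)

module PrefixSearch {Choice Witness : Set}
  (Certifies    : List Bool → Witness → Set)
  (certifies?   : ∀ ρ w → Dec (Certifies ρ w))
  (certifies-++ : ∀ ρ σ {w} → Certifies ρ w → Certifies (ρ ++ σ) w)
  (candidates   : Choice → List Witness)
  where

  settled      : List Choice → List Bool → Bool
  settledAfter : Choice → List Choice → List Bool → Bool

  settled []       ρ = false
  settled (c ∷ cs) ρ = settledAfter c cs (ρ ∷ʳ false) ∧ settledAfter c cs (ρ ∷ʳ true)

  settledAfter c cs ρ = isYes (any? (certifies? ρ) (candidates c)) ∨ settled cs ρ

  settled-sound      : ∀ cs ρ → T (settled cs ρ) → (f : Choice → Bool) → ∃ (Certifies (ρ ++ map f cs))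
  settledAfter-sound : ∀ c cs ρ → T (settledAfter c cs ρ) → (f : Choice → Bool) → ∃ (Certifies (ρ ++ map f cs))

  settled-sound (c ∷ cs) ρ h f =
    subst (∃ ∘ Certifies) (∷ʳ-++ ρ (f c) (map f cs)) (settledAfter-sound c cs (ρ ∷ʳ f c) (branch (f c)) f)
    where
    branch : ∀ b → T (settledAfter c cs (ρ ∷ʳ b))
    branch false = proj₁ (to T-∧ h)
    branch true  = proj₂ (to T-∧ h)

  settledAfter-sound c cs ρ h f with to T-∨ h
  ... | inj₁ found =
    let w , cert = satisfied (toWitness {a? = any? (certifies? ρ) (candidates c)} found)
    in  w , certifies-++ ρ (map f cs) cert
  ... | inj₂ rest  = settled-sound cs ρ rest f

triangular : ℕ → ℕ
triangular zero    = zero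
triangular (suc m) = m + triangular m

module _ {n : ℕ} where

  edges : List (Fin n × Fin n)
  edges = filter (λ e → proj₂ e <? proj₁ e) (cartesianProduct (allFin n) (allFin n))

  edgeIndex : Fin n → Fin n → ℕ
  edgeIndex v u = triangular (toℕ v) + toℕ u

  -- ρ holds the adjacency bits of the first (length ρ) pairs of edges.
  entry : List Bool → Fin n → Fin n → Maybe Bool
  entry ρ v u with <-cmp u v
  ... | tri< _ _ _ = ρ !? edgeIndex v u
  ... | tri≈ _ _ _ = just false
  ... | tri> _ _ _ = ρ !? edgeIndex u v

  surelyAdjacent possiblyAdjacent : List Bool → Fin n → Fin n → Bool
  surelyAdjacent   ρ v u = fromMaybe false (entry ρ v u)
  possiblyAdjacent ρ v u = fromMaybe true  (entry ρ v u)

  entry-++ : ∀ ρ σ v u {b} → entry ρ v u ≡ just b → entry (ρ ++ σ) v u ≡ just b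
  entry-++ ρ σ v u with <-cmp u v
  ... | tri< _ _ _ = !?-++ ρ σ (edgeIndex v u)
  ... | tri≈ _ _ _ = λ eq → eq
  ... | tri> _ _ _ = !?-++ ρ σ (edgeIndex u v)

  surelyAdjacent-++ : ∀ ρ σ v u → surelyAdjacent ρ v u ≡ true → surelyAdjacent (ρ ++ σ) v u ≡ true
  surelyAdjacent-++ ρ σ v u h with entry ρ v u in eq
  ... | just b = trans (cong (fromMaybe false) (entry-++ ρ σ v u eq)) h

  possiblyAdjacent-++ : ∀ ρ σ v u → possiblyAdjacent (ρ ++ σ) v u ≡ true → possiblyAdjacent ρ v u ≡ true
  possiblyAdjacent-++ ρ σ v u h with entry ρ v u in eq
  ... | nothing = refl
  ... | just b  = trans (cong (fromMaybe true) (≡.sym (entry-++ ρ σ v u eq))) h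

  data Certificate : Set where
    triangle  : Fin n → Fin n → Fin n → Certificate
    sparseSet : Subset n → Certificate

  module _ (k j : ℕ) where

    Certifies : List Bool → Certificate → Set
    Certifies ρ (triangle x y z) =
      surelyAdjacent ρ x y ≡ true × surelyAdjacent ρ y z ≡ true × surelyAdjacent ρ x z ≡ true
    Certifies ρ (sparseSet S) =
      ∣ S ∣ ≡ j × (∀ v → v ∈ S → ∣ S ∩ tabulate (possiblyAdjacent ρ v) ∣ ≤ k)

    certifies? : ∀ ρ w → Dec (Certifies ρ w)
    certifies? ρ (triangle x y z) = (_ ≟ᵇ true) ×-dec (_ ≟ᵇ true) ×-dec (_ ≟ᵇ true)
    certifies? ρ (sparseSet S)    =
      (∣ S ∣ ℕ.≟ j) ×-dec all? λ v → v ∈? S →-dec ∣ S ∩ tabulate (possiblyAdjacent ρ v) ∣ ℕ.≤? k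

    certifies-++ : ∀ ρ σ {w} → Certifies ρ w → Certifies (ρ ++ σ) w
    certifies-++ ρ σ {triangle x y z} (xy , yz , xz) =
      surelyAdjacent-++ ρ σ x y xy , surelyAdjacent-++ ρ σ y z yz , surelyAdjacent-++ ρ σ x z xz
    certifies-++ ρ σ {sparseSet S} (∣S∣≡j , sparse) = ∣S∣≡j , λ v v∈S →
      ℕ.≤-trans (p⊆q⇒∣p∣≤∣q∣ (∩-tabulate-⊆ S (possiblyAdjacent-++ ρ σ v))) (sparse v v∈S)

    -- The candidates at a pair are the triangles and j-sets whose last pair
    -- in edges it is.  Soundness does not depend on this choice, only
    -- whether the search closes.
    candidates : Fin n × Fin n → List Certificate
    candidates (v , u) =
      map (triangle v u) below ++ map (λ ws → sparseSet (⋃ (map ⁅_⁆ (v ∷ u ∷ ws)))) (combinations (j ∸ 2) below)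
      where
      below = filter (_<? u) (allFin n)

    open PrefixSearch Certifies certifies? certifies-++ candidates public

  graphBits : Graph n → List Bool
  graphBits G = map (uncurry (adj G)) edges

  EdgesIndexed : Set
  EdgesIndexed = ∀ v u → u <ᶠ v → edges !? edgeIndex v u ≡ just (v , u)

  module _ (indexed : EdgesIndexed) (G : Graph n) where

    graphBits-!? : ∀ {v u} → u <ᶠ v → graphBits G !? edgeIndex v u ≡ just (adj G v u)
    graphBits-!? {v} {u} u<v =
      trans (!?-map (uncurry (adj G)) edges (edgeIndex v u)) (cong (Maybe.map (uncurry (adj G))) (indexed v u u<v))

    entry-graphBits : ∀ v u → entry (graphBits G) v u ≡ just (adj G v u)
    entry-graphBits v u with <-cmp u v
    ... | tri< u<v _ _  = graphBits-!? u<v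
    ... | tri≈ _ refl _ = cong just (≡.sym (irrefl G v))
    ... | tri> _ _ v<u  = trans (graphBits-!? v<u) (cong just (sym G u v))

    certified⇒hasSparseSet : ∀ {k j} → TriangleFree G → ∀ w → Certifies k j (graphBits G) w → HasSparseSet k j G
    certified⇒hasSparseSet tf (triangle x y z) (xy , yz , xz) = ⊥-elim (tf x y z (adjacent xy) (adjacent yz) (adjacent xz))
      where
      adjacent : ∀ {a b} → surelyAdjacent (graphBits G) a b ≡ true → adj G a b ≡ true
      adjacent {a} {b} = trans (cong (fromMaybe false) (≡.sym (entry-graphBits a b)))
    certified⇒hasSparseSet {k} tf (sparseSet S) (∣S∣≡j , sparse) = S , ∣S∣≡j , λ v v∈S →
      subst (λ N → ∣ S ∩ N ∣ ≤ k) (tabulate-cong (cong (fromMaybe true) ∘ entry-graphBits v)) (sparse v v∈S)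

  settled⇒good : ∀ k j → EdgesIndexed → settled k j edges [] ≡ true → Good k j n
  settled⇒good k j indexed closed G tf =
    let w , cert = settled-sound k j edges [] (from (T-≡ {settled k j edges []}) closed) (uncurry (adj G))
    in  certified⇒hasSparseSet indexed G tf w cert

edgesIndexed-9 : EdgesIndexed {9}
edgesIndexed-9 = toWitness {a? = all? λ v → all? λ u → u <? v →-dec
  Maybe.≡-dec (Product.≡-dec _≟_ _≟_) (edges !? edgeIndex v u) (just (v , u))} (from T-≡ refl)

sparse? : ∀ {n} k (G : Graph n) S → Dec (Sparse k G S)
sparse? k G S = all? λ v → v ∈? S →-dec ∣ S ∩ nbhd G v ∣ ℕ.≤? k

hasSparseSet? : ∀ {n} k j (G : Graph n) → Dec (HasSparseSet k j G)
hasSparseSet? k j G = anySubset? λ S → (∣ S ∣ ℕ.≟ j) ×-dec sparse? k G S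

completeBipartite : ∀ {n} → (Fin n → Bool) → Graph n
completeBipartite side = record
  { adj    = λ u v → side u xor side v
  ; sym    = λ u v → xor-comm (side u) (side v)
  ; irrefl = λ v → xor-same (side v)
  }

completeBipartite-triangleFree : ∀ {n} (side : Fin n → Bool) → TriangleFree (completeBipartite side)
completeBipartite-triangleFree side u v w with side u | side v | side w
... | true  | true  | _     = λ ()
... | false | false | _     = λ ()
... | true  | false | false = λ _ ()
... | false | true  | true  = λ _ ()
... | true  | false | true  = λ _ _ ()
... | false | true  | false = λ _ _ ()

lowerHalf : ∀ {n} → Fin n → Bool
lowerHalf v = toℕ v <ᵇ 4

K₄₄ : ∀ n → Graph n
K₄₄ n = completeBipartite lowerHalf

K₄₄-noSparseSet : ∀ (m : Fin 9) → ¬ HasSparseSet 2 5 (K₄₄ (toℕ m))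
K₄₄-noSparseSet = toWitness {a? = all? λ m → ¬? (hasSparseSet? 2 5 (K₄₄ (toℕ m)))} (from T-≡ refl)

lowerBound : ∀ m → m < 9 → ¬ Good 2 5 m
lowerBound m m<9 good =
  subst (λ m → ¬ HasSparseSet 2 5 (K₄₄ m)) (toℕ-fromℕ< m<9) (K₄₄-noSparseSet (fromℕ< m<9))
    (good (K₄₄ m) (completeBipartite-triangleFree lowerHalf))

upperBound : Good 2 5 9
upperBound = settled⇒good 2 5 edgesIndexed-9 refl

theorem3p4 : T≡ 2 5 9
theorem3p4 = upperBound , lowerBound
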